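{- Let $(G,F)$ be a framed graph and let $C_1\ne C_2$ be maximal cliques with $C_2=(C_1\setminus\{R_1\})\cup\{R_2\}$. Then: (i) $R_1$ and $R_2$ are incoherent at some vertex $v$; furthermore they are incoherent at every vertex of the maximal path $P_v$ in $R_1\cap R_2$ containing $v$. (ii) The routes $R_1vR_2$ and $R_2vR_1$ are contained in $C_1\cap C_2$. (iii) $R_1$ and $R_2$ are incoherent only at the vertices of $P_v$.
   Context: A flow graph $G$ is a finite directed acyclic multigraph with linearly ordered vertices, edges directed from smaller to larger vertices, a unique source $s$ and unique sink $t$; a route is a directed $s$–$t$ path. A framing $F$ gives at each vertex $v$ linear orders $\le_{\mathrm{In}(v)}$, $\le_{\mathrm{Out}(v)}$ on entering and leaving edges. For a path $P$ through $v$, $Pv$ (resp. $vP$) is the maximal subpath of $P$ ending (resp. starting) at $v$. For $Pv,Qv$, let $w$ be the first vertex after which they coincide; if $w$ is the first vertex of one of them they are equal, else $Pv<_{\mathscr I(v)}Qv$ iff $P$'s edge entering $w$ precedes $Q$'s in $\le_{\mathrm{In}(w)}$. Dually for $vP,vQ$ with $w'$ the last vertex before which they coincide, using $\le_{\mathrm{Out}(w')}$, giving $<_{\mathscr O(v)}$. For paths with common inner vertex $v$ (neither first nor last vertex), they are incoherent at $v$ if either ($Pv<_{\mathscr I(v)}Qv$ and $vQ<_{\mathscr O(v)}vP$) or ($Qv<_{\mathscr I(v)}Pv$ and $vP<_{\mathscr O(v)}vQ$), and coherent if incoherent at no common inner vertex. A clique is a set of pairwise coherent routes; maximal cliques are maximal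 under inclusion. For routes $R,R'$ through $v$, $RvR'$ denotes the route consisting of $Rv$ followed by $vR'$. -}

module Defs where

open import Data.Nat using (ℕ)
open import Data.Fin using (Fin; _<_)
open import Data.List using (List; []; _∷_; _++_)
open import Data.Bool using (Bool; true)
open import Data.Product using (Σ; ∃; ∃-syntax; _×_; proj₁)
open import Data.Sum using (_⊎_)
open import Relation.Binary using (Rel; IsStrictTotalOrder)
open import Relation.Binary.PropositionalEquality using (_≡_; _≢_; refl)
open import Relation.Nullary using (¬_)
open import Level using (0ℓ)

-- A flow graph: vertices Fin n (linearly ordered as Fin), edges Fin m
-- (multigraph: parallel edges allowed), every edge goes from a smaller to a
-- larger vertex (hence acyclic), a unique source s and a unique sink t.
record FlowGraph : Set where
  field
    n m      : ℕ
    src tgt  : Fin m → Fin n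
    src<tgt  : ∀ e → src e < tgt e
    s t      : Fin n
    s-source : ∀ e → tgt e ≢ s
    s-unique : ∀ v → (∀ e → tgt e ≢ v) → v ≡ s
    t-sink   : ∀ e → src e ≢ t
    t-unique : ∀ v → (∀ e → src e ≢ v) → v ≡ t

module _ (G : FlowGraph) where
  open FlowGraph G

  Edge : Set
  Edge = Fin m

  InEdge : Fin n → Set
  InEdge v = Σ Edge (λ e → tgt e ≡ v)

  OutEdge : Fin n → Set
  OutEdge v = Σ Edge (λ e → src e ≡ v)

  record Framing : Set₁ where
    field
      inLt     : (v : Fin n) → Rel (InEdge v) 0ℓ
      inOrder  : ∀ v → IsStrictTotalOrder _≡_ (inLt v)
      outLt    : (v : Fin n) → Rel (OutEdge v) 0ℓ
      outOrder : ∀ v → IsStrictTotalOrder _≡_ (outLt v)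

  data IsPath : Fin n → Fin n → List Edge → Set where
    nil  : ∀ {u} → IsPath u u []
    cons : ∀ {u w e es} → src e ≡ u → IsPath (tgt e) w es → IsPath u w (e ∷ es)

  Route : List Edge → Set
  Route R = IsPath s t R

  -- R passes through v, with Rv = X and vR = Y.
  SplitAt : List Edge → Fin n → List Edge → List Edge → Set
  SplitAt R v X Y = (R ≡ X ++ Y) × IsPath s v X × IsPath v t Y

  Segment : List Edge → Fin n → Fin n → List Edge → Set
  Segment R a b S = ∃[ A ] ∃[ B ] ((R ≡ A ++ (S ++ B)) × IsPath s a A × IsPath a b S × IsPath b t B)

  -- u is a vertex of the maximal path P_v in R₁ ∩ R₂ containing v
  -- (i.e. R₁ and R₂ share the same subpath between u and v).
  OnPv : List Edge → List Edge → Fin n → Fin n → Set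
  OnPv R₁ R₂ v u = ∃[ S ] ((Segment R₁ u v S × Segment R₂ u v S) ⊎ (Segment R₁ v u S × Segment R₂ v u S))

  module _ (F : Framing) where
    open Framing F

    -- Pv <_{I(v)} Qv, for X = Pv, Y = Qv (paths ending at the same vertex):
    -- writing X = A ++ a ∷ C, Y = B ++ b ∷ C with a ≢ b (so C is the maximal
    -- common final part, starting at w = tgt a = tgt b, and w is not the first
    -- vertex of either), a precedes b in ≤_{In(w)}.
    InLess : List Edge → List Edge → Set
    InLess X Y = ∃[ A ] ∃[ B ] ∃[ C ] ∃[ a ] ∃[ b ]
      ((X ≡ A ++ (a ∷ C)) × (Y ≡ B ++ (b ∷ C)) × (a ≢ b) ×
       Σ (tgt b ≡ tgt a) (λ eq → inLt (tgt a) (a Data.Product., refl) (b Data.Product., eq)))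

    OutLess : List Edge → List Edge → Set
    OutLess X Y = ∃[ A ] ∃[ B ] ∃[ C ] ∃[ a ] ∃[ b ]
      ((X ≡ C ++ (a ∷ A)) × (Y ≡ C ++ (b ∷ B)) × (a ≢ b) ×
       Σ (src b ≡ src a) (λ eq → outLt (src a) (a Data.Product., refl) (b Data.Product., eq)))

    Incoherent : List Edge → List Edge → Fin n → Set
    Incoherent P Q v = (v ≢ s) × (v ≢ t) ×
      ∃[ X₁ ] ∃[ Y₁ ] ∃[ X₂ ] ∃[ Y₂ ] (SplitAt P v X₁ Y₁ × SplitAt Q v X₂ Y₂ ×
        ((InLess X₁ X₂ × OutLess Y₂ Y₁) ⊎ (InLess X₂ X₁ × OutLess Y₁ Y₂)))

    Coherent : List Edge → List Edge → Set
    Coherent P Q = ∀ v → ¬ Incoherent P Q v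

    -- sets of routes (finite objects, so decidable subsets of edge sequences)
    RouteSet : Set
    RouteSet = List Edge → Bool

    _∈ₛ_ : List Edge → RouteSet → Set
    R ∈ₛ C = C R ≡ true

    _⊆ₛ_ : RouteSet → RouteSet → Set
    C ⊆ₛ D = ∀ R → R ∈ₛ C → R ∈ₛ D

    IsClique : RouteSet → Set
    IsClique C = (∀ R → R ∈ₛ C → Route R) × (∀ P Q → P ∈ₛ C → Q ∈ₛ C → Coherent P Q)

    IsMaximalClique : RouteSet → Set
    IsMaximalClique C = IsClique C × (∀ D → IsClique D → C ⊆ₛ D → D ⊆ₛ C)

-- Let v be the largest vertex at which R₁ and R₂ are incoherent; one exists, for otherwise R₂
-- would be coherent with every route of C₁ and maximality would put R₂ into C₁, forcing C₁ = C₂.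
-- Every route Q ≠ R₁ of C₁ lies in C₂, so it is coherent with both R₁ and R₂, and transitivity
-- of the in- and out-orders makes it coherent with the splice R₁vR₂ as well; R₁ itself is
-- coherent with R₁vR₂ because a crossing of the two would lie beyond v, where the splice
-- follows R₂. Maximality of C₁ then absorbs R₁vR₂, and symmetrically C₂ absorbs R₂vR₁.
-- Incoherence propagates along the common path P_v since comparisons only look at where the
-- paths differ. Conversely, if R₁ and R₂ are incoherent at some u < v and reach v along
-- different segments, then R₁vR₂ and R₂ are incoherent at u, although both lie in C₂.

module Submission where

open import Defs
open import Level using (0ℓ)
import Data.Nat as ℕ
open import Data.Nat using (z≤n; s≤s)
import Data.Nat.Properties as ℕₚ
open import Data.Fin using (Fin; zero; suc; _≤_; _<_)
import Data.Fin.Properties as Finₚ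
open import Data.List using (List; []; _∷_; _++_; [_]; reverse)
open import Data.List.Properties
  using (++-assoc; ++-identityʳ; ++-cancelˡ; ∷-injectiveˡ; ∷-injectiveʳ; ≡-dec;
         unfold-reverse; reverse-++; reverse-selfInverse; reverse-involutive)
open import Data.Product using (Σ; ∃; ∃₂; ∃-syntax; _×_; _,_; proj₁; proj₂; map; map₁; map₂)
open import Data.Product.Function.NonDependent.Propositional using (_×-⇔_)
open import Data.Sum as Sum using (_⊎_; inj₁; inj₂)
open import Data.Sum.Function.Propositional using (_⊎-⇔_)
open import Data.Bool using (true; false; _∨_)
open import Data.Bool.Properties using (⇔→≡; not-¬)
open import Data.Empty using (⊥-elim)
open import Function using (_∘_)
open import Function.Bundles using (_⇔_; mk⇔; module Equivalence)
import Function.Properties.Equivalence as ⇔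
open import Relation.Binary
  using (Rel; Decidable; DecidableEquality; IsStrictPartialOrder; IsStrictTotalOrder)
open import Relation.Binary.PropositionalEquality hiding ([_])
open import Relation.Nullary using (¬_; Dec; yes; no; does)
open import Relation.Nullary.Decidable using (map′; _×-dec_; _⊎-dec_)
open import Relation.Unary using (Pred)
open import Axiom.UniquenessOfIdentityProofs using (module Decidable⇒UIP)

module _ {A : Set} where

  ++-≡-++ : ∀ (S T C D : List A) → S ++ T ≡ C ++ D →
    (∃ λ M → C ≡ S ++ M × T ≡ M ++ D) ⊎ (∃ λ M → S ≡ C ++ M × D ≡ M ++ T)
  ++-≡-++ []      T C       D eq = inj₁ (C , refl , eq)
  ++-≡-++ (x ∷ S) T []      D eq = inj₂ (x ∷ S , refl , sym eq)
  ++-≡-++ (x ∷ S) T (y ∷ C) D eq with ∷-injectiveˡ eq | ++-≡-++ S T C D (∷-injectiveʳ eq)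
  ... | refl | inj₁ (M , C≡ , T≡) = inj₁ (M , cong (x ∷_) C≡ , T≡)
  ... | refl | inj₂ (M , S≡ , D≡) = inj₂ (M , cong (x ∷_) S≡ , D≡)

  ∃-++? : {P : List A → List A → Set} → (∀ X Y → Dec (P X Y)) →
    ∀ xs → Dec (∃₂ λ X Y → xs ≡ X ++ Y × P X Y)
  ∃-++? P? [] = map′ (λ p → [] , [] , refl , p) (λ { ([] , [] , refl , p) → p }) (P? [] [])
  ∃-++? P? (x ∷ xs) with P? [] (x ∷ xs) | ∃-++? (λ X → P? (x ∷ X)) xs
  ... | yes p | _                      = yes ([] , x ∷ xs , refl , p)
  ... | no _  | yes (X , Y , refl , p) = yes (x ∷ X , Y , refl , p)
  ... | no ¬p | no ¬q = no λ where
    ([]    , _ , refl , p) → ¬p p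
    (_ ∷ X , Y , refl , p) → ¬q (X , Y , refl , p)

  reverse-++-∷ : ∀ X (a : A) Y → reverse (X ++ a ∷ Y) ≡ reverse Y ++ a ∷ reverse X
  reverse-++-∷ X a Y = begin
    reverse (X ++ a ∷ Y)              ≡⟨ reverse-++ X (a ∷ Y) ⟩
    reverse (a ∷ Y) ++ reverse X      ≡⟨ cong (_++ reverse X) (unfold-reverse a Y) ⟩
    (reverse Y ++ [ a ]) ++ reverse X ≡⟨ ++-assoc (reverse Y) [ a ] (reverse X) ⟩
    reverse Y ++ a ∷ reverse X        ∎
    where open ≡-Reasoning

  reverse-≡-++ : ∀ {Y} (M L : List A) → reverse Y ≡ reverse M ++ L → Y ≡ reverse L ++ M
  reverse-≡-++ {Y} M L eq = begin
    Y                                ≡⟨ reverse-selfInverse eq ⟨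
    reverse (reverse M ++ L)         ≡⟨ reverse-++ (reverse M) L ⟩
    reverse L ++ reverse (reverse M) ≡⟨ cong (reverse L ++_) (reverse-involutive M) ⟩
    reverse L ++ M                   ∎
    where open ≡-Reasoning

-- Unlike the lexicographic order, a proper prefix is incomparable with its extensions.
data FirstDiff {E : Set} (_≺_ : Rel E 0ℓ) : Rel (List E) 0ℓ where
  here  : ∀ {a b A B} → a ≺ b → FirstDiff _≺_ (a ∷ A) (b ∷ B)
  there : ∀ {c A B} → FirstDiff _≺_ A B → FirstDiff _≺_ (c ∷ A) (c ∷ B)

record LastDiff {E : Set} (_≺_ : Rel E 0ℓ) (X Y : List E) : Set where
  constructor reversed
  field firstDiff-reverse : FirstDiff _≺_ (reverse X) (reverse Y)

module _ {E : Set} {_≺_ : Rel E 0ℓ} where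

  private
    FD = FirstDiff _≺_
    LD = LastDiff _≺_

  firstDiff-++⁺ˡ : ∀ S {X Y} → FD X Y → FD (S ++ X) (S ++ Y)
  firstDiff-++⁺ˡ []      d = d
  firstDiff-++⁺ˡ (c ∷ S) d = there (firstDiff-++⁺ˡ S d)

  firstDiff-splitˡ : ∀ M {X Y} → FD (M ++ X) Y →
    (∀ Z → FD (M ++ Z) Y) ⊎ ∃ λ Y′ → Y ≡ M ++ Y′ × FD X Y′
  firstDiff-splitˡ []      d         = inj₂ (_ , refl , d)
  firstDiff-splitˡ (c ∷ M) (here p)  = inj₁ λ _ → here p
  firstDiff-splitˡ (c ∷ M) (there d) =
    Sum.map (λ f → there ∘ f) (λ (Y′ , Y≡ , d′) → Y′ , cong (c ∷_) Y≡ , d′) (firstDiff-splitˡ M d)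

  firstDiff-splitʳ : ∀ M {X Y} → FD Y (M ++ X) →
    (∀ Z → FD Y (M ++ Z)) ⊎ ∃ λ Y′ → Y ≡ M ++ Y′ × FD Y′ X
  firstDiff-splitʳ []      d         = inj₂ (_ , refl , d)
  firstDiff-splitʳ (c ∷ M) (here p)  = inj₁ λ _ → here p
  firstDiff-splitʳ (c ∷ M) (there d) =
    Sum.map (λ f → there ∘ f) (λ (Y′ , Y≡ , d′) → Y′ , cong (c ∷_) Y≡ , d′) (firstDiff-splitʳ M d)

  lastDiff-++⁺ʳ : ∀ S {X Y} → LD X Y → LD (X ++ S) (Y ++ S)
  lastDiff-++⁺ʳ S {X} {Y} (reversed d) = reversed
    (subst₂ FD (sym (reverse-++ X S)) (sym (reverse-++ Y S)) (firstDiff-++⁺ˡ (reverse S) d))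

  lastDiff-splitˡ : ∀ X M {Y} → LD (X ++ M) Y →
    (∀ Z → LD (Z ++ M) Y) ⊎ ∃ λ Y′ → Y ≡ Y′ ++ M × LD X Y′
  lastDiff-splitˡ X M {Y} (reversed d)
    with firstDiff-splitˡ (reverse M) (subst (λ L → FD L (reverse Y)) (reverse-++ X M) d)
  ... | inj₁ f = inj₁ λ Z →
    reversed (subst (λ L → FD L (reverse Y)) (sym (reverse-++ Z M)) (f (reverse Z)))
  ... | inj₂ (L , Y≡ , d′) = inj₂
    (reverse L , reverse-≡-++ M L Y≡ ,
     reversed (subst (FD (reverse X)) (sym (reverse-involutive L)) d′))

  lastDiff-splitʳ : ∀ X M {Y} → LD Y (X ++ M) →
    (∀ Z → LD Y (Z ++ M)) ⊎ ∃ λ Y′ → Y ≡ Y′ ++ M × LD Y′ X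
  lastDiff-splitʳ X M {Y} (reversed d)
    with firstDiff-splitʳ (reverse M) (subst (FD (reverse Y)) (reverse-++ X M) d)
  ... | inj₁ f = inj₁ λ Z → reversed (subst (FD (reverse Y)) (sym (reverse-++ Z M)) (f (reverse Z)))
  ... | inj₂ (L , Y≡ , d′) = inj₂
    (reverse L , reverse-≡-++ M L Y≡ ,
     reversed (subst (λ L′ → FD L′ (reverse X)) (sym (reverse-involutive L)) d′))

module StrictDiff {E : Set} {_≺_ : Rel E 0ℓ} (≺-isSPO : IsStrictPartialOrder _≡_ _≺_) where

  open IsStrictPartialOrder ≺-isSPO using () renaming (irrefl to ≺-irrefl; trans to ≺-trans)

  private
    FD = FirstDiff _≺_
    LD = LastDiff _≺_

  firstDiff⇒≢ : ∀ {X Y} → FD X Y → X ≢ Y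
  firstDiff⇒≢ (here p)  refl = ≺-irrefl refl p
  firstDiff⇒≢ (there d) refl = firstDiff⇒≢ d refl

  firstDiff-trans : ∀ {X Y Z} → FD X Y → FD Y Z → FD X Z
  firstDiff-trans (here p)  (here q)  = here (≺-trans p q)
  firstDiff-trans (here p)  (there _) = here p
  firstDiff-trans (there _) (here q)  = here q
  firstDiff-trans (there d) (there e) = there (firstDiff-trans d e)

  firstDiff-++⁻ˡ : ∀ S {X Y} → FD (S ++ X) (S ++ Y) → FD X Y
  firstDiff-++⁻ˡ []      d         = d
  firstDiff-++⁻ˡ (c ∷ S) (here p)  = ⊥-elim (≺-irrefl refl p)
  firstDiff-++⁻ˡ (c ∷ S) (there d) = firstDiff-++⁻ˡ S d

  firstDiff? : DecidableEquality E → Decidable _≺_ → Decidable FD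
  firstDiff? _≟_ _≺?_ []      _       = no λ ()
  firstDiff? _≟_ _≺?_ (_ ∷ _) []      = no λ ()
  firstDiff? _≟_ _≺?_ (a ∷ A) (b ∷ B) with a ≟ b
  ... | yes refl = map′ there (λ { (here p) → ⊥-elim (≺-irrefl refl p) ; (there d) → d })
                        (firstDiff? _≟_ _≺?_ A B)
  ... | no a≢b   = map′ here (λ { (here p) → p ; (there _) → ⊥-elim (a≢b refl) }) (a ≺? b)

  firstDiff⇔ : ∀ {X Y} → FD X Y ⇔
    (∃[ A ] ∃[ B ] ∃[ C ] ∃[ a ] ∃[ b ]
      ((X ≡ C ++ (a ∷ A)) × (Y ≡ C ++ (b ∷ B)) × (a ≢ b) × a ≺ b))
  firstDiff⇔ = mk⇔ witness λ { (_ , _ , C , _ , _ , refl , refl , _ , p) → firstDiff-++⁺ˡ C (here p) }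
    where
      witness : ∀ {X Y} → FD X Y → ∃[ A ] ∃[ B ] ∃[ C ] ∃[ a ] ∃[ b ]
        ((X ≡ C ++ (a ∷ A)) × (Y ≡ C ++ (b ∷ B)) × (a ≢ b) × a ≺ b)
      witness (here p) = _ , _ , [] , _ , _ , refl , refl , (λ { refl → ≺-irrefl refl p }) , p
      witness {c ∷ _} (there d) with witness d
      ... | A , B , C , a , b , refl , refl , a≢b , p = A , B , c ∷ C , a , b , refl , refl , a≢b , p

  lastDiff⇒≢ : ∀ {X Y} → LD X Y → X ≢ Y
  lastDiff⇒≢ (reversed d) = firstDiff⇒≢ d ∘ cong reverse

  lastDiff-trans : ∀ {X Y Z} → LD X Y → LD Y Z → LD X Z
  lastDiff-trans (reversed d) (reversed e) = reversed (firstDiff-trans d e)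

  lastDiff-++⁻ʳ : ∀ S {X Y} → LD (X ++ S) (Y ++ S) → LD X Y
  lastDiff-++⁻ʳ S {X} {Y} (reversed d) =
    reversed (firstDiff-++⁻ˡ (reverse S) (subst₂ FD (reverse-++ X S) (reverse-++ Y S) d))

  lastDiff? : DecidableEquality E → Decidable _≺_ → Decidable LD
  lastDiff? _≟_ _≺?_ X Y =
    map′ reversed LastDiff.firstDiff-reverse (firstDiff? _≟_ _≺?_ (reverse X) (reverse Y))

  lastDiff⇔ : ∀ {X Y} → LD X Y ⇔
    (∃[ A ] ∃[ B ] ∃[ C ] ∃[ a ] ∃[ b ]
      ((X ≡ A ++ (a ∷ C)) × (Y ≡ B ++ (b ∷ C)) × (a ≢ b) × a ≺ b))
  lastDiff⇔ = mk⇔ witness λ { (A , B , C , a , b , refl , refl , _ , p) →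
      reversed (subst₂ FD (sym (reverse-++-∷ A a C)) (sym (reverse-++-∷ B b C))
                          (firstDiff-++⁺ˡ (reverse C) (here p))) }
    where
      reverse-flip : ∀ {X A} {a : E} {C} → reverse X ≡ C ++ a ∷ A → X ≡ reverse A ++ a ∷ reverse C
      reverse-flip {a = a} {C} eq = trans (sym (reverse-selfInverse eq)) (reverse-++-∷ C a _)

      witness : ∀ {X Y} → LD X Y → ∃[ A ] ∃[ B ] ∃[ C ] ∃[ a ] ∃[ b ]
        ((X ≡ A ++ (a ∷ C)) × (Y ≡ B ++ (b ∷ C)) × (a ≢ b) × a ≺ b)
      witness (reversed d) with Equivalence.to firstDiff⇔ d
      ... | A , B , C , a , b , X≡ , Y≡ , a≢b , p =
        reverse A , reverse B , reverse C , a , b , reverse-flip X≡ , reverse-flip Y≡ , a≢b , p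

module FibreOrder {E V : Set} (f : E → V) (_≟_ : DecidableEquality V)
  (lt : (v : V) → Rel (Σ E λ e → f e ≡ v) 0ℓ) (lt-isSTO : ∀ v → IsStrictTotalOrder _≡_ (lt v)) where

  open Decidable⇒UIP _≟_ using (≡-irrelevant)
  private module STO v = IsStrictTotalOrder (lt-isSTO v)

  _≺_ : Rel E 0ℓ
  a ≺ b = Σ (f b ≡ f a) λ eq → lt (f a) (a , refl) (b , eq)

  private
    fibre-≡ : ∀ {v} {x y : Σ E λ e → f e ≡ v} → proj₁ x ≡ proj₁ y → x ≡ y
    fibre-≡ {x = e , p} {.e , q} refl = cong (e ,_) (≡-irrelevant p q)

    lt-cast : ∀ {v w x y x′ y′} → v ≡ w → proj₁ x ≡ proj₁ x′ → proj₁ y ≡ proj₁ y′ →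
      lt v x y → lt w x′ y′
    lt-cast refl p q = subst₂ (lt _) (fibre-≡ p) (fibre-≡ q)

  ≺-isStrictPartialOrder : IsStrictPartialOrder _≡_ _≺_
  ≺-isStrictPartialOrder = record
    { isEquivalence = isEquivalence
    ; irrefl        = λ { {a} refl (_ , p) → STO.irrefl (f a) (fibre-≡ refl) p }
    ; trans         = λ (eq₁ , p) (eq₂ , q) → trans eq₂ eq₁ , STO.trans _ p (lt-cast eq₁ refl refl q)
    ; <-resp-≈      = resp₂ _≺_
    }

  _≺?_ : Decidable _≺_
  a ≺? b with f b ≟ f a
  ... | no fb≢fa = no (fb≢fa ∘ proj₁)
  ... | yes eq   = map′ (eq ,_) (λ (_ , p) → lt-cast refl refl refl p)
                        (STO._<?_ (f a) (a , refl) (b , eq))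

largest : ∀ {n} {P : Pred (Fin n) 0ℓ} → (∀ v → Dec (P v)) →
  (∀ v → ¬ P v) ⊎ ∃ λ v → P v × (∀ u → P u → u ≤ v)
largest {ℕ.zero}  P? = inj₁ λ ()
largest {ℕ.suc n} P? with largest (P? ∘ suc)
... | inj₂ (v , p , max) = inj₂ (suc v , p , λ { zero _ → z≤n ; (suc u) q → s≤s (max u q) })
... | inj₁ none with P? zero
...   | yes p = inj₂ (zero , p , λ { zero _ → z≤n ; (suc u) q → ⊥-elim (none u q) })
...   | no ¬p = inj₁ λ { zero → ¬p ; (suc u) → none u }

module Paths (G : FlowGraph) where
  open FlowGraph G

  Path : Fin n → Fin n → List (Edge G) → Set
  Path = IsPath G

  Split : List (Edge G) → Fin n → List (Edge G) → List (Edge G) → Set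
  Split = SplitAt G

  path-≤ : ∀ {u w es} → Path u w es → u ≤ w
  path-≤ nil                   = ℕₚ.≤-refl
  path-≤ (cons {e = e} refl p) = ℕₚ.≤-trans (ℕₚ.<⇒≤ (src<tgt e)) (path-≤ p)

  path-< : ∀ {u w e es} → Path u w (e ∷ es) → u < w
  path-< (cons {e = e} refl p) = ℕₚ.<-≤-trans (src<tgt e) (path-≤ p)

  loop-empty : ∀ {u es} → Path u u es → es ≡ []
  loop-empty nil          = refl
  loop-empty p@(cons _ _) = ⊥-elim (ℕₚ.<-irrefl refl (path-< p))

  empty-path : ∀ {u w} → Path u w [] → u ≡ w
  empty-path nil = refl

  distinct-paths⇒< : ∀ {v w M M′} → Path v w M → Path v w M′ → M ≢ M′ → v < w
  distinct-paths⇒< nil          p′ M≢M′ = ⊥-elim (M≢M′ (sym (loop-empty p′)))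
  distinct-paths⇒< p@(cons _ _) _  _    = path-< p

  path? : ∀ u w es → Dec (Path u w es)
  path? u w []       = map′ (λ { refl → nil }) empty-path (u Finₚ.≟ w)
  path? u w (e ∷ es) = map′ (λ (e≡ , p) → cons e≡ p) (λ { (cons e≡ p) → e≡ , p })
                            (src e Finₚ.≟ u ×-dec path? (tgt e) w es)

  path-++ : ∀ {a b c X Y} → Path a b X → Path b c Y → Path a c (X ++ Y)
  path-++ nil        q = q
  path-++ (cons e p) q = cons e (path-++ p q)

  path-++⁻ : ∀ {a c} X {Y} → Path a c (X ++ Y) → ∃ λ b → Path a b X × Path b c Y
  path-++⁻ []      p          = _ , nil , p
  path-++⁻ (_ ∷ X) (cons e p) with path-++⁻ X p
  ... | b , p₁ , p₂ = b , cons e p₁ , p₂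

  target-unique : ∀ {a b b′ X} → Path a b X → Path a b′ X → b ≡ b′
  target-unique nil        nil        = refl
  target-unique (cons _ p) (cons _ q) = target-unique p q

  source-unique : ∀ {a a′ b X} → Path a b X → Path a′ b X → a ≡ a′
  source-unique nil        nil         = refl
  source-unique (cons e _) (cons e′ _) = trans (sym e) e′

  path-++⁻ʳ : ∀ {a v c X M} → Path a v X → Path a c (X ++ M) → Path v c M
  path-++⁻ʳ {X = X} pX pXM with path-++⁻ X pXM
  ... | _ , p₁ , p₂ = subst (λ z → Path z _ _) (target-unique p₁ pX) p₂

  path-++⁻ˡ : ∀ {a v c X M} → Path v c M → Path a c (X ++ M) → Path a v X
  path-++⁻ˡ {X = X} pM pXM with path-++⁻ X pXM
  ... | _ , p₁ , p₂ = subst (λ z → Path _ z _) (source-unique p₂ pM) p₁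

  prefix-unique : ∀ {u v S₁ S₂ Z₁ Z₂} → Path u v S₁ → Path u v S₂ → S₁ ++ Z₁ ≡ S₂ ++ Z₂ → S₁ ≡ S₂
  prefix-unique nil          nil          _ = refl
  prefix-unique nil          q@(cons _ _) _ = ⊥-elim (ℕₚ.<-irrefl refl (path-< q))
  prefix-unique p@(cons _ _) nil          _ = ⊥-elim (ℕₚ.<-irrefl refl (path-< p))
  prefix-unique (cons {e = e} _ p) (cons _ q) eq with ∷-injectiveˡ eq
  ... | refl = cong (e ∷_) (prefix-unique p q (∷-injectiveʳ eq))

  suffix-unique : ∀ {u v T₁ T₂} Z₁ Z₂ → Path u v T₁ → Path u v T₂ → Z₁ ++ T₁ ≡ Z₂ ++ T₂ → T₁ ≡ T₂
  suffix-unique {T₁ = T₁} {T₂} Z₁ Z₂ p₁ p₂ eq with ++-≡-++ Z₁ T₁ Z₂ T₂ eq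
  ... | inj₁ (_ , _ , refl) with loop-empty (path-++⁻ˡ p₂ p₁)
  ...   | refl = refl
  suffix-unique {T₁ = T₁} {T₂} Z₁ Z₂ p₁ p₂ eq | inj₂ (_ , _ , refl) with loop-empty (path-++⁻ˡ p₁ p₂)
  ...   | refl = refl

  split-unique : ∀ {R v X Y X′ Y′} → Split R v X Y → Split R v X′ Y′ → X ≡ X′ × Y ≡ Y′
  split-unique {X = X} (R≡ , pX , _) (R≡′ , pX′ , _) with prefix-unique pX pX′ (trans (sym R≡) R≡′)
  ... | refl = refl , ++-cancelˡ X _ _ (trans (sym R≡) R≡′)

  split-forward : ∀ {R v w X Y M} → Path v w M → Split R v X (M ++ Y) → Split R w (X ++ M) Y
  split-forward {X = X} {Y} {M} pM (R≡ , pX , pMY) =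
    trans R≡ (sym (++-assoc X M Y)) , path-++ pX pM , path-++⁻ʳ pM pMY

  split-backward : ∀ {R v w X Y M} → Path v w M → Split R w (X ++ M) Y → Split R v X (M ++ Y)
  split-backward {X = X} {Y} {M} pM (R≡ , pXM , pY) =
    trans R≡ (++-assoc X M Y) , path-++⁻ˡ pM pXM , path-++ pM pY

  split-order : ∀ {R v w X Y X′ Y′} → Split R v X Y → Split R w X′ Y′ →
    (∃ λ M → Path v w M × X′ ≡ X ++ M × Y ≡ M ++ Y′) ⊎
    (∃ λ M → Path w v M × X ≡ X′ ++ M × Y′ ≡ M ++ Y)
  split-order {X = X} {Y} {X′} {Y′} (R≡ , pX , _) (R≡′ , pX′ , _)
    with ++-≡-++ X Y X′ Y′ (trans (sym R≡) R≡′)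
  ... | inj₁ (M , refl , Y≡)  = inj₁ (M , path-++⁻ʳ pX pX′ , refl , Y≡)
  ... | inj₂ (M , refl , Y′≡) = inj₂ (M , path-++⁻ʳ pX′ pX , refl , Y′≡)

  split-order-≤ : ∀ {R v w X Y X′ Y′} → Split R v X Y → Split R w X′ Y′ → v ≤ w →
    ∃ λ M → Path v w M × X′ ≡ X ++ M × Y ≡ M ++ Y′
  split-order-≤ {X = X} {X′ = X′} sp sp′ v≤w with split-order sp sp′
  ... | inj₁ later = later
  ... | inj₂ (M , pM , X≡ , Y′≡) with Finₚ.≤-antisym v≤w (path-≤ pM)
  ...   | refl with loop-empty pM
  ...     | refl = [] , nil , sym (trans (++-identityʳ X) (trans X≡ (++-identityʳ X′))) , sym Y′≡

module Framed (G : FlowGraph) (F : Framing G) where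
  open FlowGraph G
  open Framing F
  open Paths G
  open Equivalence

  private
    module In  = FibreOrder tgt Finₚ._≟_ inLt inOrder
    module Out = FibreOrder src Finₚ._≟_ outLt outOrder
    open StrictDiff In.≺-isStrictPartialOrder
      using (lastDiff⇒≢; lastDiff-trans; lastDiff-++⁻ʳ; lastDiff?; lastDiff⇔)
    open StrictDiff Out.≺-isStrictPartialOrder
      using (firstDiff⇒≢; firstDiff-trans; firstDiff-++⁻ˡ; firstDiff?; firstDiff⇔)

  _≟ᴸ_ : DecidableEquality (List (Edge G))
  _≟ᴸ_ = ≡-dec Finₚ._≟_

  _∈_ : List (Edge G) → RouteSet G F → Set
  R ∈ C = _∈ₛ_ G F R C

  _<ᴵ_ _<ᴼ_ : Rel (List (Edge G)) 0ℓ
  _<ᴵ_ = LastDiff In._≺_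
  _<ᴼ_ = FirstDiff Out._≺_

  Crossing : (X₁ Y₁ X₂ Y₂ : List (Edge G)) → Set
  Crossing X₁ Y₁ X₂ Y₂ = (X₁ <ᴵ X₂ × Y₂ <ᴼ Y₁) ⊎ (X₂ <ᴵ X₁ × Y₁ <ᴼ Y₂)

  Incoherent′ : List (Edge G) → List (Edge G) → Fin n → Set
  Incoherent′ P Q v = v ≢ s × v ≢ t ×
    ∃[ X₁ ] ∃[ Y₁ ] ∃[ X₂ ] ∃[ Y₂ ] (Split P v X₁ Y₁ × Split Q v X₂ Y₂ × Crossing X₁ Y₁ X₂ Y₂)

  Coherent′ : List (Edge G) → List (Edge G) → Set
  Coherent′ P Q = ∀ v → ¬ Incoherent′ P Q v

  crossing⇔ : ∀ {X₁ Y₁ X₂ Y₂} →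
    ((InLess G F X₁ X₂ × OutLess G F Y₂ Y₁) ⊎ (InLess G F X₂ X₁ × OutLess G F Y₁ Y₂)) ⇔
    Crossing X₁ Y₁ X₂ Y₂
  crossing⇔ = (⇔.sym lastDiff⇔ ×-⇔ ⇔.sym firstDiff⇔) ⊎-⇔ (⇔.sym lastDiff⇔ ×-⇔ ⇔.sym firstDiff⇔)

  incoherent⇔ : ∀ {P Q v} → Incoherent G F P Q v ⇔ Incoherent′ P Q v
  incoherent⇔ = mk⇔
    (λ (v≢s , v≢t , X₁ , Y₁ , X₂ , Y₂ , sp₁ , sp₂ , c) →
       v≢s , v≢t , X₁ , Y₁ , X₂ , Y₂ , sp₁ , sp₂ , to crossing⇔ c)
    (λ (v≢s , v≢t , X₁ , Y₁ , X₂ , Y₂ , sp₁ , sp₂ , c) →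
       v≢s , v≢t , X₁ , Y₁ , X₂ , Y₂ , sp₁ , sp₂ , from crossing⇔ c)

  coherent⇔ : ∀ {P Q} → Coherent G F P Q ⇔ Coherent′ P Q
  coherent⇔ = mk⇔ (λ coh v → coh v ∘ from incoherent⇔) (λ coh v → coh v ∘ to incoherent⇔)

  crossing-sym : ∀ {X₁ Y₁ X₂ Y₂} → Crossing X₁ Y₁ X₂ Y₂ → Crossing X₂ Y₂ X₁ Y₁
  crossing-sym = Sum.swap

  incoherent′-sym : ∀ {P Q v} → Incoherent′ P Q v → Incoherent′ Q P v
  incoherent′-sym (v≢s , v≢t , _ , _ , _ , _ , sp₁ , sp₂ , c) =
    v≢s , v≢t , _ , _ , _ , _ , sp₂ , sp₁ , crossing-sym c

  coherent′-sym : ∀ {P Q} → Coherent′ P Q → Coherent′ Q P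
  coherent′-sym coh v = coh v ∘ incoherent′-sym

  crossing⇒≢ᴵ : ∀ {X₁ Y₁ X₂ Y₂} → Crossing X₁ Y₁ X₂ Y₂ → X₁ ≢ X₂
  crossing⇒≢ᴵ (inj₁ (i , _)) = lastDiff⇒≢ i
  crossing⇒≢ᴵ (inj₂ (i , _)) = lastDiff⇒≢ i ∘ sym

  crossing⇒≢ᴼ : ∀ {X₁ Y₁ X₂ Y₂} → Crossing X₁ Y₁ X₂ Y₂ → Y₁ ≢ Y₂
  crossing⇒≢ᴼ (inj₁ (_ , o)) = firstDiff⇒≢ o ∘ sym
  crossing⇒≢ᴼ (inj₂ (_ , o)) = firstDiff⇒≢ o

  coherent′-refl : ∀ P → Coherent′ P P
  coherent′-refl P v (_ , _ , _ , _ , _ , _ , sp , sp′ , c) =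
    crossing⇒≢ᴵ c (proj₁ (split-unique sp sp′))

  crossing-splice : ∀ {X₁ Y₁ X₂ Y₂ Z W} → Crossing X₁ Y₁ X₂ Y₂ → Crossing X₁ Y₂ Z W →
    Crossing X₁ Y₁ Z W ⊎ Crossing X₂ Y₂ Z W
  crossing-splice (inj₁ (_ , o₂₁)) (inj₁ (i , o)) = inj₁ (inj₁ (i , firstDiff-trans o o₂₁))
  crossing-splice (inj₂ (i₂₁ , _)) (inj₁ (i , o)) = inj₂ (inj₁ (lastDiff-trans i₂₁ i , o))
  crossing-splice (inj₁ (i₁₂ , _)) (inj₂ (i , o)) = inj₂ (inj₂ (lastDiff-trans i i₁₂ , o))
  crossing-splice (inj₂ (_ , o₁₂)) (inj₂ (i , o)) = inj₁ (inj₂ (i , firstDiff-trans o₁₂ o))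

  crossing-moveʳ : ∀ S {A₁ B₁ A₂ B₂} →
    Crossing (A₁ ++ S) B₁ (A₂ ++ S) B₂ → Crossing A₁ (S ++ B₁) A₂ (S ++ B₂)
  crossing-moveʳ S = Sum.map (map (lastDiff-++⁻ʳ S) (firstDiff-++⁺ˡ S))
                             (map (lastDiff-++⁻ʳ S) (firstDiff-++⁺ˡ S))

  crossing-moveˡ : ∀ S {A₁ B₁ A₂ B₂} →
    Crossing A₁ (S ++ B₁) A₂ (S ++ B₂) → Crossing (A₁ ++ S) B₁ (A₂ ++ S) B₂
  crossing-moveˡ S = Sum.map (map (lastDiff-++⁺ʳ S) (firstDiff-++⁻ˡ S))
                             (map (lastDiff-++⁺ʳ S) (firstDiff-++⁻ˡ S))

  -- Two distinct paths v → w diverge before w, so the comparison happens inside them.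
  <ᴵ-shift : ∀ {v w M M′ P Q} → Path v w M → Path v w M′ → M ≢ M′ →
    (P ++ M) <ᴵ (Q ++ M′) → ∀ P′ Q′ → (P′ ++ M) <ᴵ (Q′ ++ M′)
  <ᴵ-shift {M = M} {M′} {P} {Q} pM pM′ M≢M′ d P′ Q′ with lastDiff-splitˡ P M d
  ... | inj₂ (Y , Q++M′≡ , _) = ⊥-elim (M≢M′ (sym (suffix-unique Q Y pM′ pM Q++M′≡)))
  ... | inj₁ f with lastDiff-splitʳ Q M′ (f P′)
  ...   | inj₁ g                = g Q′
  ...   | inj₂ (Y , P′++M≡ , _) = ⊥-elim (M≢M′ (suffix-unique P′ Y pM pM′ P′++M≡))

  <ᴼ-shift : ∀ {v w M M′ P Q} → Path v w M → Path v w M′ → M ≢ M′ →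
    (M ++ P) <ᴼ (M′ ++ Q) → ∀ P′ Q′ → (M ++ P′) <ᴼ (M′ ++ Q′)
  <ᴼ-shift {M = M} {M′} pM pM′ M≢M′ d P′ Q′ with firstDiff-splitˡ M d
  ... | inj₂ (Y , M′++Q≡ , _) = ⊥-elim (M≢M′ (sym (prefix-unique pM′ pM M′++Q≡)))
  ... | inj₁ f with firstDiff-splitʳ M′ (f P′)
  ...   | inj₁ g                = g Q′
  ...   | inj₂ (Y , M++P′≡ , _) = ⊥-elim (M≢M′ (prefix-unique pM pM′ M++P′≡))

  crossing-shiftᴵ : ∀ {v w M M′ P Q Y Y′} → Path v w M → Path v w M′ → M ≢ M′ →
    Crossing (P ++ M) Y (Q ++ M′) Y′ → ∀ P′ Q′ → Crossing (P′ ++ M) Y (Q′ ++ M′) Y′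
  crossing-shiftᴵ pM pM′ M≢M′ c P′ Q′ =
    Sum.map (map₁ λ i → <ᴵ-shift pM pM′ M≢M′ i P′ Q′)
            (map₁ λ i → <ᴵ-shift pM′ pM (M≢M′ ∘ sym) i Q′ P′) c

  crossing-shiftᴼ : ∀ {v w M M′ P Q X X′} → Path v w M → Path v w M′ → M ≢ M′ →
    Crossing X (M ++ P) X′ (M′ ++ Q) → ∀ P′ Q′ → Crossing X (M ++ P′) X′ (M′ ++ Q′)
  crossing-shiftᴼ pM pM′ M≢M′ c P′ Q′ =
    Sum.map (map₂ λ o → <ᴼ-shift pM′ pM (M≢M′ ∘ sym) o Q′ P′)
            (map₂ λ o → <ᴼ-shift pM pM′ M≢M′ o P′ Q′) c

  onPv⇒incoherent′ : ∀ {R₁ R₂ v u} → Incoherent′ R₁ R₂ v → OnPv G R₁ R₂ v u → Incoherent′ R₁ R₂ u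
  onPv⇒incoherent′ (v≢s , v≢t , _ , _ , _ , _ , sp₁ , sp₂ , c)
                   (S , inj₁ ((A₁ , B₁ , R₁≡ , pA₁ , pS , pB₁) , (A₂ , B₂ , R₂≡ , pA₂ , _ , pB₂)))
    with split-unique sp₁ (split-forward pS (R₁≡ , pA₁ , path-++ pS pB₁))
       | split-unique sp₂ (split-forward pS (R₂≡ , pA₂ , path-++ pS pB₂))
  ... | refl , refl | refl , refl =
    u≢s , u≢t , A₁ , S ++ B₁ , A₂ , S ++ B₂ ,
    (R₁≡ , pA₁ , path-++ pS pB₁) , (R₂≡ , pA₂ , path-++ pS pB₂) , crossing-moveʳ S c
    where
      u≢s : _ ≢ s
      u≢s refl = crossing⇒≢ᴵ c (cong (_++ S) (trans (loop-empty pA₁) (sym (loop-empty pA₂))))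
      u≢t : _ ≢ t
      u≢t refl = v≢t (Finₚ.≤-antisym (path-≤ pB₁) (path-≤ pS))
  onPv⇒incoherent′ (v≢s , v≢t , _ , _ , _ , _ , sp₁ , sp₂ , c)
                   (S , inj₂ ((A₁ , B₁ , R₁≡ , pA₁ , pS , pB₁) , (A₂ , B₂ , R₂≡ , pA₂ , _ , pB₂)))
    with split-unique sp₁ (R₁≡ , pA₁ , path-++ pS pB₁) | split-unique sp₂ (R₂≡ , pA₂ , path-++ pS pB₂)
  ... | refl , refl | refl , refl =
    u≢s , u≢t , A₁ ++ S , B₁ , A₂ ++ S , B₂ ,
    split-forward pS sp₁ , split-forward pS sp₂ , crossing-moveˡ S c
    where
      u≢s : _ ≢ s
      u≢s refl = v≢s (Finₚ.≤-antisym (path-≤ pS) (path-≤ pA₁))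
      u≢t : _ ≢ t
      u≢t refl = crossing⇒≢ᴼ c (cong (S ++_) (trans (loop-empty pB₁) (sym (loop-empty pB₂))))

  coherent⇒splice-uncrossed : ∀ {R₁ R₂ v X₁ Y₁ X₂ Y₂ P Z W} → v ≢ s → v ≢ t →
    Split R₁ v X₁ Y₁ → Split R₂ v X₂ Y₂ → Crossing X₁ Y₁ X₂ Y₂ →
    Coherent′ R₁ P → Coherent′ R₂ P → Split P v Z W → ¬ Crossing X₁ Y₂ Z W
  coherent⇒splice-uncrossed {v = v} v≢s v≢t sp₁ sp₂ c coh₁ coh₂ spP c′ with crossing-splice c c′
  ... | inj₁ c₁ = coh₁ v (v≢s , v≢t , _ , _ , _ , _ , sp₁ , spP , c₁)
  ... | inj₂ c₂ = coh₂ v (v≢s , v≢t , _ , _ , _ , _ , sp₂ , spP , c₂)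

  -- A crossing of the splice with P at w ≠ v is, through the part shared with R₁ or R₂,
  -- either a crossing of P with that route at w or a crossing of P with the splice at v.
  splice-coherent : ∀ {R₁ R₂ v X₁ Y₁ X₂ Y₂ P} → v ≢ s → v ≢ t →
    Split R₁ v X₁ Y₁ → Split R₂ v X₂ Y₂ → Crossing X₁ Y₁ X₂ Y₂ →
    Coherent′ R₁ P → Coherent′ R₂ P → Coherent′ (X₁ ++ Y₂) P
  splice-coherent {R₁} {R₂} {v} {X₁} {Y₁} {X₂} {Y₂} {P} v≢s v≢t sp₁ sp₂ c coh₁ coh₂ w
                  (w≢s , w≢t , Xw , wX , _ , _ , spw , spP , c′)
    with split-order (refl , proj₁ (proj₂ sp₁) , proj₂ (proj₂ sp₂)) spw
  ... | inj₁ (M , pM , refl , refl) = after spP c′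
    where
      uncrossed-at-v : ∀ {Z W} → Split P v Z W → ¬ Crossing X₁ (M ++ wX) Z W
      uncrossed-at-v = coherent⇒splice-uncrossed v≢s v≢t sp₁ sp₂ c coh₁ coh₂

      R₂-at-w : Split R₂ w (X₂ ++ M) wX
      R₂-at-w = split-forward pM sp₂

      after : ∀ {Pw wP} → Split P w Pw wP → ¬ Crossing (X₁ ++ M) wX Pw wP
      after spP (inj₁ (i , o)) with lastDiff-splitˡ X₁ M i
      ... | inj₁ f = coh₂ w (w≢s , w≢t , _ , _ , _ , _ , R₂-at-w , spP , inj₁ (f X₂ , o))
      ... | inj₂ (_ , refl , i′) =
        uncrossed-at-v (split-backward pM spP) (inj₁ (i′ , firstDiff-++⁺ˡ M o))
      after spP (inj₂ (i , o)) with lastDiff-splitʳ X₁ M i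
      ... | inj₁ g = coh₂ w (w≢s , w≢t , _ , _ , _ , _ , R₂-at-w , spP , inj₂ (g X₂ , o))
      ... | inj₂ (_ , refl , i′) =
        uncrossed-at-v (split-backward pM spP) (inj₂ (i′ , firstDiff-++⁺ˡ M o))
  ... | inj₂ (M , pM , refl , refl) = before spP c′
    where
      uncrossed-at-v : ∀ {Z W} → Split P v Z W → ¬ Crossing (Xw ++ M) Y₂ Z W
      uncrossed-at-v = coherent⇒splice-uncrossed v≢s v≢t sp₁ sp₂ c coh₁ coh₂

      R₁-at-w : Split R₁ w Xw (M ++ Y₁)
      R₁-at-w = split-backward pM sp₁

      before : ∀ {Pw wP} → Split P w Pw wP → ¬ Crossing Xw (M ++ Y₂) Pw wP
      before spP (inj₁ (i , o)) with firstDiff-splitʳ M o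
      ... | inj₁ g = coh₁ w (w≢s , w≢t , _ , _ , _ , _ , R₁-at-w , spP , inj₁ (i , g Y₁))
      ... | inj₂ (_ , refl , o′) =
        uncrossed-at-v (split-forward pM spP) (inj₁ (lastDiff-++⁺ʳ M i , o′))
      before spP (inj₂ (i , o)) with firstDiff-splitˡ M o
      ... | inj₁ g = coh₁ w (w≢s , w≢t , _ , _ , _ , _ , R₁-at-w , spP , inj₂ (i , g Y₁))
      ... | inj₂ (_ , refl , o′) =
        uncrossed-at-v (split-forward pM spP) (inj₂ (lastDiff-++⁺ʳ M i , o′))

  -- Beyond v the splice follows R₂, so a crossing with R₁ there is, after replacing the
  -- common prefix X₁ by X₂, a crossing of R₁ and R₂ after v.
  splice-coherent-left : ∀ {R₁ R₂ v X₁ Y₁ X₂ Y₂} → Split R₁ v X₁ Y₁ → Split R₂ v X₂ Y₂ →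
    (∀ u → Incoherent′ R₁ R₂ u → u ≤ v) → Coherent′ (X₁ ++ Y₂) R₁
  splice-coherent-left {X₁ = X₁} {X₂ = X₂} sp₁ sp₂ v-largest w
                       (w≢s , w≢t , _ , _ , _ , _ , spw , sp₁w , c)
    with split-order (refl , proj₁ (proj₂ sp₁) , proj₂ (proj₂ sp₂)) spw
  ... | inj₂ (M , pM , refl , refl) =
    crossing⇒≢ᴵ c (sym (proj₁ (split-unique sp₁w (split-backward pM sp₁))))
  ... | inj₁ (M , pM , refl , refl) with split-order-≤ sp₁ sp₁w (path-≤ pM)
  ...   | M′ , pM′ , refl , refl with M ≟ᴸ M′
  ...     | yes refl = crossing⇒≢ᴵ c refl
  ...     | no M≢M′  = ℕₚ.<⇒≱ (distinct-paths⇒< pM pM′ M≢M′)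
                         (v-largest w (w≢s , w≢t , _ , _ , _ , _ , sp₁w , split-forward pM sp₂ ,
                                      crossing-sym (crossing-shiftᴵ pM pM′ M≢M′ c X₂ X₁)))

  -- Off P_v the routes reach v along distinct segments S₁, S₂ from u, and then the splice
  -- R₁vR₂ = U₁S₁Y₂ crosses R₂ = U₂S₂Y₂ at u.
  incoherent′⇒onPv : ∀ {R₁ R₂ v X₁ Y₁ X₂ Y₂ u} → Split R₁ v X₁ Y₁ → Split R₂ v X₂ Y₂ →
    (∀ u → Incoherent′ R₁ R₂ u → u ≤ v) → Coherent′ (X₁ ++ Y₂) R₂ →
    Incoherent′ R₁ R₂ u → OnPv G R₁ R₂ v u
  incoherent′⇒onPv {Y₂ = Y₂} {u} sp₁@(_ , _ , pY₁) sp₂@(_ , _ , pY₂) v-largest coh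
                   inc@(u≢s , u≢t , U₁ , _ , U₂ , _ , spu₁@(R₁≡ , pU₁ , _) , spu₂@(R₂≡ , pU₂ , _) , c)
    with split-order-≤ spu₁ sp₁ (v-largest u inc) | split-order-≤ spu₂ sp₂ (v-largest u inc)
  ... | S₁ , pS₁ , refl , refl | S₂ , pS₂ , refl , refl with S₁ ≟ᴸ S₂
  ...   | yes refl = S₁ , inj₁ ((U₁ , _ , R₁≡ , pU₁ , pS₁ , pY₁) , (U₂ , _ , R₂≡ , pU₂ , pS₂ , pY₂))
  ...   | no S₁≢S₂ = ⊥-elim (coh u (u≢s , u≢t , _ , _ , _ , _ ,
                       (++-assoc U₁ S₁ Y₂ , pU₁ , path-++ pS₁ pY₂) , spu₂ ,
                       crossing-shiftᴼ pS₁ pS₂ S₁≢S₂ c Y₂ Y₂))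

  crossing? : ∀ X₁ Y₁ X₂ Y₂ → Dec (Crossing X₁ Y₁ X₂ Y₂)
  crossing? X₁ Y₁ X₂ Y₂ =
    (lastDiff? Finₚ._≟_ In._≺?_ X₁ X₂ ×-dec firstDiff? Finₚ._≟_ Out._≺?_ Y₂ Y₁) ⊎-dec
    (lastDiff? Finₚ._≟_ In._≺?_ X₂ X₁ ×-dec firstDiff? Finₚ._≟_ Out._≺?_ Y₁ Y₂)

  split? : ∀ R v → Dec (∃₂ (Split R v))
  split? R v = ∃-++? (λ X Y → path? s v X ×-dec path? v t Y) R

  incoherent′? : ∀ P Q v → Dec (Incoherent′ P Q v)
  incoherent′? P Q v with v Finₚ.≟ s | v Finₚ.≟ t | split? P v | split? Q v
  ... | yes v≡s | _       | _      | _      = no λ inc → proj₁ inc v≡s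
  ... | no _    | yes v≡t | _      | _      = no λ inc → proj₁ (proj₂ inc) v≡t
  ... | no _    | no _    | no ¬sp | _      = no λ (_ , _ , X , Y , _ , _ , sp , _) → ¬sp (X , Y , sp)
  ... | no _    | no _    | yes _  | no ¬sp = no λ (_ , _ , _ , _ , X , Y , _ , sp , _) →
                                                   ¬sp (X , Y , sp)
  ... | no v≢s  | no v≢t  | yes (X₁ , Y₁ , sp₁) | yes (X₂ , Y₂ , sp₂) =
    map′ (λ c → v≢s , v≢t , _ , _ , _ , _ , sp₁ , sp₂ , c) crossing-at-splits (crossing? X₁ Y₁ X₂ Y₂)
    where
      crossing-at-splits : Incoherent′ P Q v → Crossing X₁ Y₁ X₂ Y₂
      crossing-at-splits (_ , _ , _ , _ , _ , _ , sp₁′ , sp₂′ , c)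
        with split-unique sp₁′ sp₁ | split-unique sp₂′ sp₂
      ... | refl , refl | refl , refl = c

  insert : List (Edge G) → RouteSet G F → RouteSet G F
  insert X C R = does (R ≟ᴸ X) ∨ C R

  ∈-insert⁻ : ∀ X C {R} → R ∈ insert X C → R ≡ X ⊎ R ∈ C
  ∈-insert⁻ X C {R} h with R ≟ᴸ X
  ... | yes R≡X = inj₁ R≡X
  ... | no _    = inj₂ h

  ∈-insert⁺ : ∀ X C {R} → R ≡ X ⊎ R ∈ C → R ∈ insert X C
  ∈-insert⁺ X C {R} h with R ≟ᴸ X | h
  ... | yes _  | _        = refl
  ... | no R≢X | inj₁ R≡X = ⊥-elim (R≢X R≡X)
  ... | no _   | inj₂ r   = r

  maximal-absorbs : ∀ {C X} → IsMaximalClique G F C → Route G X →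
    (∀ Q → Q ∈ C → Coherent G F X Q) → X ∈ C
  maximal-absorbs {C} {X} ((routes , coherent) , maximal) rX cohX =
    maximal (insert X C) (routes⁺ , coherent⁺) (λ _ → ∈-insert⁺ X C ∘ inj₂)
            X (∈-insert⁺ X C (inj₁ refl))
    where
      routes⁺ : ∀ R → R ∈ insert X C → Route G R
      routes⁺ R h with ∈-insert⁻ X C h
      ... | inj₁ refl = rX
      ... | inj₂ r    = routes R r

      coherent⁺ : ∀ P Q → P ∈ insert X C → Q ∈ insert X C → Coherent G F P Q
      coherent⁺ P Q hP hQ with ∈-insert⁻ X C hP | ∈-insert⁻ X C hQ
      ... | inj₁ refl | inj₁ refl = from coherent⇔ (coherent′-refl X)
      ... | inj₁ refl | inj₂ q    = cohX Q q
      ... | inj₂ p    | inj₁ refl = from coherent⇔ (coherent′-sym (to coherent⇔ (cohX P p)))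
      ... | inj₂ p    | inj₂ q    = coherent P Q p q

  maximal-⊆⇒≗ : ∀ {C D} → IsMaximalClique G F C → IsClique G F D → _⊆ₛ_ G F C D → C ≗ D
  maximal-⊆⇒≗ (_ , maximal) D-clique C⊆D R = ⇔→≡ (mk⇔ (C⊆D R) (maximal _ D-clique C⊆D R))

  splice∈ : ∀ {C R R′ v X Y X′ Y′} → IsMaximalClique G F C → R ∈ C →
    (∀ Q → Q ∈ C → Q ≢ R → Coherent G F R′ Q) →
    v ≢ s → v ≢ t → Split R v X Y → Split R′ v X′ Y′ → Crossing X Y X′ Y′ →
    (∀ u → Incoherent′ R R′ u → u ≤ v) → (X ++ Y′) ∈ C
  splice∈ {C} {R} {X = X} {Y′ = Y′} max@((_ , coherent) , _) R∈C R′-coherent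
          v≢s v≢t sp@(_ , pX , _) sp′@(_ , _ , pY′) c v-largest =
    maximal-absorbs max (path-++ pX pY′) splice-coherent-with
    where
      splice-coherent-with : ∀ Q → Q ∈ C → Coherent G F (X ++ Y′) Q
      splice-coherent-with Q q with Q ≟ᴸ R
      ... | yes refl = from coherent⇔ (splice-coherent-left sp sp′ v-largest)
      ... | no Q≢R   = from coherent⇔ (splice-coherent v≢s v≢t sp sp′ c
                         (to coherent⇔ (coherent R Q R∈C q)) (to coherent⇔ (R′-coherent Q q Q≢R)))

module Exchange (G : FlowGraph) (F : Framing G) {C₁ C₂ : RouteSet G F} {R₁ R₂ : List (Edge G)}
  (max₁ : IsMaximalClique G F C₁) (max₂ : IsMaximalClique G F C₂) (C₁≢C₂ : ¬ C₁ ≗ C₂)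
  (C₂≡ : ∀ R → _⇔_ (_∈ₛ_ G F R C₂) ((_∈ₛ_ G F R C₁ × R ≢ R₁) ⊎ R ≡ R₂)) where

  open FlowGraph G
  open Paths G
  open Framed G F
  open Equivalence

  C₁⁻⊆C₂ : ∀ {Q} → Q ∈ C₁ → Q ≢ R₁ → Q ∈ C₂
  C₁⁻⊆C₂ q Q≢R₁ = from (C₂≡ _) (inj₁ (q , Q≢R₁))

  C₂⁻⊆C₁ : ∀ {Q} → Q ∈ C₂ → Q ≢ R₂ → Q ∈ C₁
  C₂⁻⊆C₁ q Q≢R₂ with to (C₂≡ _) q
  ... | inj₁ (q₁ , _) = q₁
  ... | inj₂ Q≡R₂     = ⊥-elim (Q≢R₂ Q≡R₂)

  R₂∈C₂ : R₂ ∈ C₂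
  R₂∈C₂ = from (C₂≡ R₂) (inj₂ refl)

  R₁∈C₁ : R₁ ∈ C₁
  R₁∈C₁ with C₁ R₁ in R₁∉C₁
  ... | true  = refl
  ... | false = ⊥-elim (C₁≢C₂ (maximal-⊆⇒≗ max₁ (proj₁ max₂) λ _ q →
                  C₁⁻⊆C₂ q λ { refl → not-¬ q R₁∉C₁ }))

  R₂∉C₁ : ¬ R₂ ∈ C₁
  R₂∉C₁ R₂∈C₁ = C₁≢C₂ (sym ∘ maximal-⊆⇒≗ max₂ (proj₁ max₁) C₂⊆C₁)
    where
      C₂⊆C₁ : _⊆ₛ_ G F C₂ C₁
      C₂⊆C₁ Q q with to (C₂≡ Q) q
      ... | inj₁ (q₁ , _) = q₁
      ... | inj₂ refl     = R₂∈C₁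

  R₁R₂-incoherent : ¬ Coherent′ R₁ R₂
  R₁R₂-incoherent coh = R₂∉C₁ (maximal-absorbs max₁ (proj₁ (proj₁ max₂) R₂ R₂∈C₂) R₂-coherent)
    where
      R₂-coherent : ∀ Q → Q ∈ C₁ → Coherent G F R₂ Q
      R₂-coherent Q q with Q ≟ᴸ R₁
      ... | yes refl = from coherent⇔ (coherent′-sym coh)
      ... | no Q≢R₁  = proj₂ (proj₁ max₂) R₂ Q R₂∈C₂ (C₁⁻⊆C₂ q Q≢R₁)

  module AtLargestCrossing {v X₁ Y₁ X₂ Y₂} (v≢s : v ≢ s) (v≢t : v ≢ t)
    (sp₁ : Split R₁ v X₁ Y₁) (sp₂ : Split R₂ v X₂ Y₂) (c : Crossing X₁ Y₁ X₂ Y₂)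
    (v-largest : ∀ u → Incoherent′ R₁ R₂ u → u ≤ v) where

    X₁Y₂∈C₁ : (X₁ ++ Y₂) ∈ C₁
    X₁Y₂∈C₁ = splice∈ max₁ R₁∈C₁ (λ Q q Q≢R₁ → proj₂ (proj₁ max₂) R₂ Q R₂∈C₂ (C₁⁻⊆C₂ q Q≢R₁))
                      v≢s v≢t sp₁ sp₂ c v-largest

    X₂Y₁∈C₂ : (X₂ ++ Y₁) ∈ C₂
    X₂Y₁∈C₂ = splice∈ max₂ R₂∈C₂ (λ Q q Q≢R₂ → proj₂ (proj₁ max₁) R₁ Q R₁∈C₁ (C₂⁻⊆C₁ q Q≢R₂))
                      v≢s v≢t sp₂ sp₁ (crossing-sym c) (λ u → v-largest u ∘ incoherent′-sym)

    X₁Y₂∈C₂ : (X₁ ++ Y₂) ∈ C₂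
    X₁Y₂∈C₂ = C₁⁻⊆C₂ X₁Y₂∈C₁ λ X₁Y₂≡R₁ →
      crossing⇒≢ᴼ c (++-cancelˡ X₁ _ _ (trans (sym (proj₁ sp₁)) (sym X₁Y₂≡R₁)))

    X₂Y₁∈C₁ : (X₂ ++ Y₁) ∈ C₁
    X₂Y₁∈C₁ = C₂⁻⊆C₁ X₂Y₁∈C₂ λ X₂Y₁≡R₂ →
      crossing⇒≢ᴼ c (++-cancelˡ X₂ _ _ (trans X₂Y₁≡R₂ (proj₁ sp₂)))

    splices∈ : ∀ X₁′ Y₁′ X₂′ Y₂′ → Split R₁ v X₁′ Y₁′ → Split R₂ v X₂′ Y₂′ →
      ((X₁′ ++ Y₂′) ∈ C₁ × (X₁′ ++ Y₂′) ∈ C₂) × ((X₂′ ++ Y₁′) ∈ C₁ × (X₂′ ++ Y₁′) ∈ C₂)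
    splices∈ _ _ _ _ sp₁′ sp₂′ with split-unique sp₁ sp₁′ | split-unique sp₂ sp₂′
    ... | refl , refl | refl , refl = (X₁Y₂∈C₁ , X₁Y₂∈C₂) , (X₂Y₁∈C₁ , X₂Y₁∈C₂)

    incoherences-on-Pv : ∀ u → Incoherent′ R₁ R₂ u → OnPv G R₁ R₂ v u
    incoherences-on-Pv u =
      incoherent′⇒onPv sp₁ sp₂ v-largest (to coherent⇔ (proj₂ (proj₁ max₂) _ _ X₁Y₂∈C₂ R₂∈C₂))

lemma1p9 : (G : FlowGraph) (F : Framing G)
    (C₁ C₂ : RouteSet G F) (R₁ R₂ : List (Edge G)) →
    IsMaximalClique G F C₁ → IsMaximalClique G F C₂ →
    ¬ (∀ R → C₁ R ≡ C₂ R) →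
    (∀ R → _⇔_ (_∈ₛ_ G F R C₂) ((_∈ₛ_ G F R C₁ × R ≢ R₁) ⊎ R ≡ R₂)) →
    Σ (Fin (FlowGraph.n G)) (λ v →
      Incoherent G F R₁ R₂ v ×
      (∀ u → OnPv G R₁ R₂ v u → Incoherent G F R₁ R₂ u) ×
      (∀ X₁ Y₁ X₂ Y₂ → SplitAt G R₁ v X₁ Y₁ → SplitAt G R₂ v X₂ Y₂ →
        (_∈ₛ_ G F (X₁ ++ Y₂) C₁ × _∈ₛ_ G F (X₁ ++ Y₂) C₂) ×
        (_∈ₛ_ G F (X₂ ++ Y₁) C₁ × _∈ₛ_ G F (X₂ ++ Y₁) C₂)) ×
      (∀ u → Incoherent G F R₁ R₂ u → OnPv G R₁ R₂ v u))
lemma1p9 G F C₁ C₂ R₁ R₂ max₁ max₂ C₁≢C₂ C₂≡ with largest (Framed.incoherent′? G F R₁ R₂)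
... | inj₁ coherent = ⊥-elim (R₁R₂-incoherent coherent)
  where open Exchange G F max₁ max₂ C₁≢C₂ C₂≡
... | inj₂ (v , crossed@(v≢s , v≢t , _ , _ , _ , _ , sp₁ , sp₂ , c) , v-largest) =
  v , from incoherent⇔ crossed ,
  (λ u → from incoherent⇔ ∘ onPv⇒incoherent′ crossed) ,
  splices∈ ,
  (λ u → incoherences-on-Pv u ∘ to incoherent⇔)
  where
    open Framed G F
    open Exchange G F max₁ max₂ C₁≢C₂ C₂≡
    open AtLargestCrossing v≢s v≢t sp₁ sp₂ c v-largest
    open Equivalence
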